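{- Let $r\geq 1$ be an integer. Define integers $W(n,r)$ for $n\in\mathbb{Z}$ by $W(n,r)=0$ for $n<0$ and, for $n\ge 0$, as the coefficients of the power series expansion $$\sum_{n=0}^{\infty}W(n,r)x^n=\frac{1-x}{1-2x+x^r-x^{r+1}}.$$ For each integer $n$, let $N(n,r,0)$ be the number of binary words of length $n$ which (if $n>0$) begin with $0$ and contain no maximal run of length exactly $r$ (with $N(n,r,0)=0$ for $n<0$, and $N(0,r,0)=1$, counting the empty word). Then $W(n,r)=N(n,r,0)$ for all integers $n$.
   Context: A binary word is a finite sequence of symbols from $\{0,1\}$. A maximal run in a binary word is a maximal consecutive subword consisting of identical symbols; its length is its number of symbols. There are no words of negative length. -}

module Defs where

open import Data.Bool using (Bool; true; false; if_then_else_)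
open import Data.Bool.Properties using () renaming (_≟_ to _≟ᵇ_)
open import Data.Nat as ℕ using (ℕ; zero; suc; _∸_)
open import Data.Integer as ℤ using (ℤ; +_; -[1+_]; 0ℤ; 1ℤ)
open import Data.List using (List; []; _∷_; map; _++_; filter; length; upTo)
open import Data.List.Relation.Unary.Any using (Any; any?)
open import Relation.Nullary using (¬_; ¬?; yes; no)
open import Relation.Binary.PropositionalEquality using (_≡_)

-- Formal power series over ℤ, represented by coefficient sequences.

-- Kronecker delta: coefficient of x^k in the monomial x^j.
δ : ℕ → ℕ → ℤ
δ j k with j ℕ.≟ k
... | yes _ = 1ℤ
... | no  _ = 0ℤ

sumℤ : List ℤ → ℤ
sumℤ []       = 0ℤ
sumℤ (x ∷ xs) = x ℤ.+ sumℤ xs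

conv : (ℕ → ℤ) → (ℕ → ℤ) → ℕ → ℤ
conv a b n = sumℤ (map (λ k → a k ℤ.* b (n ∸ k)) (upTo (suc n)))

numer : ℕ → ℤ
numer k = δ 0 k ℤ.- δ 1 k

denom : ℕ → ℕ → ℤ
denom r k = ((δ 0 k ℤ.- (ℤ.+ 2) ℤ.* δ 1 k) ℤ.+ δ r k) ℤ.- δ (suc r) k

-- Binary words (0 = false, 1 = true) and maximal runs.

allWords : ℕ → List (List Bool)
allWords zero    = [] ∷ []
allWords (suc n) = map (false ∷_) (allWords n) ++ map (true ∷_) (allWords n)

words0 : ℕ → List (List Bool)
words0 zero    = [] ∷ []
words0 (suc n) = map (false ∷_) (allWords n)

-- Lengths of the maximal runs of a word, left to right.
-- runsFrom b k w: current run consists of k copies of b, remaining word w.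
runsFrom : Bool → ℕ → List Bool → List ℕ
runsFrom b k []      = k ∷ []
runsFrom b k (c ∷ w) with b ≟ᵇ c
... | yes _ = runsFrom b (suc k) w
... | no  _ = k ∷ runsFrom c 1 w

runs : List Bool → List ℕ
runs []      = []
runs (b ∷ w) = runsFrom b 1 w

HasRunOfLength : ℕ → List Bool → Set
HasRunOfLength r w = Any (_≡ r) (runs w)

N : ℤ → ℕ → ℕ
N -[1+ n ] r = 0
N (+ n)    r = length (filter (λ w → ¬? (any? (ℕ._≟ r) (runs w))) (words0 n))

-- Write c(n) = N(n,r,0). Cutting a counted word of length m+1 after its first run, of length
-- k ≠ r, leaves (up to complementation) a counted word of length m+1-k, so
-- c(0) + ... + c(m) = c(m+1) + c(m+1-r). Subtracting two consecutive instances gives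
-- c(n) - 2c(n-1) + c(n-r) - c(n-r-1) = [n = 0] - [n = 1], i.e. c satisfies the same
-- convolution equation as W. A convolution equation with a divisor of constant term 1 has a
-- unique solution, hence W = c.
module Submission where

open import Defs
open import Data.Bool using (Bool; true; false; not)
open import Data.Empty using (⊥-elim)
open import Data.Integer using (ℤ; +_; -[1+_]; _⊖_; 0ℤ; 1ℤ; _*_; _-_; -_)
import Data.Integer.Properties as ℤP
open import Data.Integer.Tactic.RingSolver using (solve-∀)
open import Data.List using (List; []; _∷_; map; _++_; filter; length; upTo)
import Data.List.Properties as ListP
open import Data.List.Relation.Unary.All using (universal)
open import Data.List.Relation.Unary.Any using (Any; any?; here; there)
open import Data.Nat as ℕ using (ℕ; zero; suc; _∸_; _≤_; _<_; _≥_; z≤n; s≤s)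
import Data.Nat.Properties as ℕP
open import Data.Nat.Induction using (<-rec)
open import Data.Product using (_,_)
open import Function using (_∘_; _∘′_)
open import Relation.Nullary using (¬_; ¬?; Dec; does; yes; no)
open import Relation.Unary using (Decidable)
open import Algebra.Properties.AbelianGroup ℤP.+-0-abelianGroup using (∙-cancelˡ)
open import Algebra.Properties.CommutativeSemigroup ℤP.+-commutativeSemigroup using (interchange)
open import Algebra.Properties.CommutativeSemigroup ℤP.*-commutativeSemigroup using (x∙yz≈y∙xz)
open import Algebra.Properties.CommutativeSemigroup ℕP.+-commutativeSemigroup using (xy∙z≈xz∙y)
open import Relation.Binary.PropositionalEquality
open ≡-Reasoning

length-filter-map : ∀ {A B : Set} {p} {P : B → Set p} (P? : Decidable P) (f : A → B) xs →
                    length (filter P? (map f xs)) ≡ length (filter (λ x → P? (f x)) xs)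
length-filter-map P? f []       = refl
length-filter-map P? f (x ∷ xs) with does (P? (f x))
... | true  = cong suc (length-filter-map P? f xs)
... | false = length-filter-map P? f xs

module Convolution where

  open import Data.Integer using (_+_)

  sumℤ-++ : ∀ xs ys → sumℤ (xs ++ ys) ≡ sumℤ xs + sumℤ ys
  sumℤ-++ []       ys = sym (ℤP.+-identityˡ _)
  sumℤ-++ (x ∷ xs) ys = trans (cong (_+_ x) (sumℤ-++ xs ys)) (sym (ℤP.+-assoc x _ _))

  module _ {A : Set} where

    sumℤ-map-+ : ∀ (f g : A → ℤ) xs →
                 sumℤ (map (λ x → f x + g x) xs) ≡ sumℤ (map f xs) + sumℤ (map g xs)
    sumℤ-map-+ f g []       = refl
    sumℤ-map-+ f g (x ∷ xs) =
      trans (cong (_+_ (f x + g x)) (sumℤ-map-+ f g xs)) (interchange (f x) (g x) _ _)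

    sumℤ-map-*ˡ : ∀ c (f : A → ℤ) xs → sumℤ (map (λ x → c * f x) xs) ≡ c * sumℤ (map f xs)
    sumℤ-map-*ˡ c f []       = sym (ℤP.*-zeroʳ c)
    sumℤ-map-*ˡ c f (x ∷ xs) =
      trans (cong (_+_ (c * f x)) (sumℤ-map-*ˡ c f xs)) (sym (ℤP.*-distribˡ-+ c (f x) _))

    sumℤ-map-neg : ∀ (f : A → ℤ) xs → sumℤ (map (λ x → - f x) xs) ≡ - sumℤ (map f xs)
    sumℤ-map-neg f []       = refl
    sumℤ-map-neg f (x ∷ xs) =
      trans (cong (_+_ (- f x)) (sumℤ-map-neg f xs)) (sym (ℤP.neg-distrib-+ (f x) _))

  sumℤ-upTo : (ℕ → ℤ) → ℕ → ℤ
  sumℤ-upTo f n = sumℤ (map f (upTo n))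

  sumℤ-upTo-suc : ∀ f n → sumℤ-upTo f (suc n) ≡ sumℤ-upTo f n + f n
  sumℤ-upTo-suc f n = begin
    sumℤ (map f (upTo (suc n)))         ≡⟨ cong (sumℤ ∘′ map f) (ListP.upTo-∷ʳ n) ⟨
    sumℤ (map f (upTo n ++ n ∷ []))     ≡⟨ cong sumℤ (ListP.map-++ f (upTo n) (n ∷ [])) ⟩
    sumℤ (map f (upTo n) ++ f n ∷ [])   ≡⟨ sumℤ-++ (map f (upTo n)) (f n ∷ []) ⟩
    sumℤ-upTo f n + (f n + 0ℤ)          ≡⟨ cong (_+_ (sumℤ-upTo f n)) (ℤP.+-identityʳ (f n)) ⟩
    sumℤ-upTo f n + f n                 ∎

  sumℤ-upTo-cong : ∀ {f g} n → (∀ k → k < n → f k ≡ g k) → sumℤ-upTo f n ≡ sumℤ-upTo g n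
  sumℤ-upTo-cong             zero    f≡g = refl
  sumℤ-upTo-cong {f} {g} (suc n) f≡g = begin
    sumℤ-upTo f (suc n) ≡⟨ sumℤ-upTo-suc f n ⟩
    sumℤ-upTo f n + f n ≡⟨ cong₂ _+_ (sumℤ-upTo-cong n (λ k k<n → f≡g k (ℕP.m<n⇒m<1+n k<n)))
                                      (f≡g n ℕP.≤-refl) ⟩
    sumℤ-upTo g n + g n ≡⟨ sumℤ-upTo-suc g n ⟨
    sumℤ-upTo g (suc n) ∎

  sumℤ-upTo-zero : ∀ f n → (∀ k → k < n → f k ≡ 0ℤ) → sumℤ-upTo f n ≡ 0ℤ
  sumℤ-upTo-zero f zero    f≡0 = refl
  sumℤ-upTo-zero f (suc n) f≡0 = begin
    sumℤ-upTo f (suc n) ≡⟨ sumℤ-upTo-suc f n ⟩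
    sumℤ-upTo f n + f n ≡⟨ cong₂ _+_ (sumℤ-upTo-zero f n (λ k k<n → f≡0 k (ℕP.m<n⇒m<1+n k<n)))
                                      (f≡0 n ℕP.≤-refl) ⟩
    0ℤ                  ∎

  sumℤ-upTo-single : ∀ f n p → p < n → (∀ k → k < n → k ≢ p → f k ≡ 0ℤ) → sumℤ-upTo f n ≡ f p
  sumℤ-upTo-single f (suc n) p p<1+n f≡0 = trans (sumℤ-upTo-suc f n) (last (p ℕ.≟ n))
    where
    last : Dec (p ≡ n) → sumℤ-upTo f n + f n ≡ f p
    last (yes refl) = begin
      sumℤ-upTo f p + f p ≡⟨ cong (_+ f p) (sumℤ-upTo-zero f p λ k k<p → f≡0 k (ℕP.m<n⇒m<1+n k<p) (ℕP.<⇒≢ k<p)) ⟩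
      0ℤ + f p            ≡⟨ ℤP.+-identityˡ (f p) ⟩
      f p                 ∎
    last (no p≢n) = begin
      sumℤ-upTo f n + f n ≡⟨ cong₂ _+_ (sumℤ-upTo-single f n p (ℕP.≤∧≢⇒< (ℕP.≤-pred p<1+n) p≢n)
                                         (λ k k<n → f≡0 k (ℕP.m<n⇒m<1+n k<n)))
                                       (f≡0 n ℕP.≤-refl (≢-sym p≢n)) ⟩
      f p + 0ℤ            ≡⟨ ℤP.+-identityʳ (f p) ⟩
      f p                 ∎

  module _ (a : ℕ → ℤ) where

    conv-+ʳ : ∀ (b c : ℕ → ℤ) n → conv a (λ k → b k + c k) n ≡ conv a b n + conv a c n
    conv-+ʳ b c n =
      trans (cong sumℤ (ListP.map-cong (λ k → ℤP.*-distribˡ-+ (a k) (b (n ∸ k)) (c (n ∸ k))) (upTo (suc n))))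
            (sumℤ-map-+ (λ k → a k * b (n ∸ k)) (λ k → a k * c (n ∸ k)) (upTo (suc n)))

    conv-*ʳ : ∀ x (b : ℕ → ℤ) n → conv a (λ k → x * b k) n ≡ x * conv a b n
    conv-*ʳ x b n =
      trans (cong sumℤ (ListP.map-cong (λ k → x∙yz≈y∙xz (a k) x (b (n ∸ k))) (upTo (suc n))))
            (sumℤ-map-*ˡ x (λ k → a k * b (n ∸ k)) (upTo (suc n)))

    conv-negʳ : ∀ (b : ℕ → ℤ) n → conv a (λ k → - b k) n ≡ - conv a b n
    conv-negʳ b n =
      trans (cong sumℤ (ListP.map-cong (λ k → sym (ℤP.neg-distribʳ-* (a k) (b (n ∸ k)))) (upTo (suc n))))
            (sumℤ-map-neg (λ k → a k * b (n ∸ k)) (upTo (suc n)))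

    conv--ʳ : ∀ (b c : ℕ → ℤ) n → conv a (λ k → b k - c k) n ≡ conv a b n - conv a c n
    conv--ʳ b c n = trans (conv-+ʳ b (λ k → - c k) n) (cong (_+_ (conv a b n)) (conv-negʳ c n))

    conv-last : ∀ b n → conv a b n ≡ sumℤ-upTo (λ k → a k * b (n ∸ k)) n + a n * b 0
    conv-last b n = trans (sumℤ-upTo-suc (λ k → a k * b (n ∸ k)) n)
                          (cong (λ i → sumℤ-upTo (λ k → a k * b (n ∸ k)) n + a n * b i) (ℕP.n∸n≡0 n))

  -- The n-th equation determines a n from the earlier values, as b 0 = 1.
  conv-injectiveˡ : ∀ {a a' b : ℕ → ℤ} → b 0 ≡ 1ℤ →
                    (∀ n → conv a b n ≡ conv a' b n) → ∀ n → a n ≡ a' n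
  conv-injectiveˡ {a} {a'} {b} b₀≡1 conv≡ = <-rec _ step
    where
    step : ∀ n → (∀ {m} → m < n → a m ≡ a' m) → a n ≡ a' n
    step n ih = begin
      a n        ≡⟨ ℤP.*-identityʳ (a n) ⟨
      a n * 1ℤ   ≡⟨ cong (a n *_) b₀≡1 ⟨
      a n * b 0  ≡⟨ ∙-cancelˡ (earlier a) (a n * b 0) (a' n * b 0) (begin
                      earlier a + a n * b 0   ≡⟨ conv-last a b n ⟨
                      conv a b n              ≡⟨ conv≡ n ⟩
                      conv a' b n             ≡⟨ conv-last a' b n ⟩
                      earlier a' + a' n * b 0 ≡⟨ cong (_+ a' n * b 0) earlier-agree ⟨
                      earlier a + a' n * b 0  ∎) ⟩
      a' n * b 0 ≡⟨ cong (a' n *_) b₀≡1 ⟩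
      a' n * 1ℤ  ≡⟨ ℤP.*-identityʳ (a' n) ⟩
      a' n       ∎
      where
      earlier : (ℕ → ℤ) → ℤ
      earlier c = sumℤ-upTo (λ k → c k * b (n ∸ k)) n
      earlier-agree : earlier a ≡ earlier a'
      earlier-agree = sumℤ-upTo-cong n (λ k k<n → cong (_* b (n ∸ k)) (ih k<n))

  δ-refl : ∀ j → δ j j ≡ 1ℤ
  δ-refl j with j ℕ.≟ j
  ... | yes _  = refl
  ... | no j≢j = ⊥-elim (j≢j refl)

  δ-≢ : ∀ {j k} → j ≢ k → δ j k ≡ 0ℤ
  δ-≢ {j} {k} j≢k with j ℕ.≟ k
  ... | yes j≡k = ⊥-elim (j≢k j≡k)
  ... | no _    = refl

  VanishesOnNegatives : (ℤ → ℤ) → Set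
  VanishesOnNegatives V = ∀ n → V -[1+ n ] ≡ 0ℤ

  vanishes-⊖ : ∀ V → VanishesOnNegatives V → ∀ {m n} → m < n → V (m ⊖ n) ≡ 0ℤ
  vanishes-⊖ V V⁻≡0 {zero}  {suc n} _         = V⁻≡0 n
  vanishes-⊖ V V⁻≡0 {suc m} {suc n} (s≤s m<n) =
    trans (cong V (ℤP.[1+m]⊖[1+n]≡m⊖n m n)) (vanishes-⊖ V V⁻≡0 m<n)

  conv-δ : ∀ V → VanishesOnNegatives V → ∀ j n → conv (λ k → V (+ k)) (δ j) n ≡ V (n ⊖ j)
  conv-δ V V⁻≡0 j n with j ℕ.≤? n
  ... | yes j≤n = begin
    conv (λ k → V (+ k)) (δ j) n      ≡⟨ sumℤ-upTo-single term (suc n) (n ∸ j) (s≤s (ℕP.m∸n≤m n j)) off-diagonal ⟩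
    V (+ (n ∸ j)) * δ j (n ∸ (n ∸ j)) ≡⟨ cong (λ i → V (+ (n ∸ j)) * δ j i) (ℕP.m∸[m∸n]≡n j≤n) ⟩
    V (+ (n ∸ j)) * δ j j             ≡⟨ cong (V (+ (n ∸ j)) *_) (δ-refl j) ⟩
    V (+ (n ∸ j)) * 1ℤ                ≡⟨ ℤP.*-identityʳ _ ⟩
    V (+ (n ∸ j))                     ≡⟨ cong V (ℤP.⊖-≥ j≤n) ⟨
    V (n ⊖ j)                         ∎
    where
    term : ℕ → ℤ
    term k = V (+ k) * δ j (n ∸ k)
    off-diagonal : ∀ k → k < suc n → k ≢ n ∸ j → term k ≡ 0ℤ
    off-diagonal k k<1+n k≢n∸j = trans (cong (V (+ k) *_) (δ-≢ λ j≡n∸k → k≢n∸j (begin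
      k           ≡⟨ ℕP.m∸[m∸n]≡n (ℕP.≤-pred k<1+n) ⟨
      n ∸ (n ∸ k) ≡⟨ cong (n ∸_) j≡n∸k ⟨
      n ∸ j       ∎))) (ℤP.*-zeroʳ (V (+ k)))
  ... | no j≰n = trans (sumℤ-upTo-zero _ (suc n) vanishing) (sym (vanishes-⊖ V V⁻≡0 (ℕP.≰⇒> j≰n)))
    where
    vanishing : ∀ k → k < suc n → V (+ k) * δ j (n ∸ k) ≡ 0ℤ
    vanishing k _ = trans (cong (V (+ k) *_) (δ-≢ λ j≡n∸k → j≰n (subst (_≤ n) (sym j≡n∸k) (ℕP.m∸n≤m n k))))
                          (ℤP.*-zeroʳ (V (+ k)))

  conv-denom : ∀ V → VanishesOnNegatives V → ∀ r n →
               conv (λ k → V (+ k)) (denom r) n ≡ ((V (+ n) - + 2 * V (n ⊖ 1)) + V (n ⊖ r)) - V (n ⊖ suc r)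
  conv-denom V V⁻≡0 r n = begin
    conv a (denom r) n
      ≡⟨ conv--ʳ a (λ k → (δ 0 k - + 2 * δ 1 k) + δ r k) (δ (suc r)) n ⟩
    conv a (λ k → (δ 0 k - + 2 * δ 1 k) + δ r k) n - conv a (δ (suc r)) n
      ≡⟨ cong (_- conv a (δ (suc r)) n) (conv-+ʳ a (λ k → δ 0 k - + 2 * δ 1 k) (δ r) n) ⟩
    (conv a (λ k → δ 0 k - + 2 * δ 1 k) n + conv a (δ r) n) - conv a (δ (suc r)) n
      ≡⟨ cong (λ i → (i + conv a (δ r) n) - conv a (δ (suc r)) n) (conv--ʳ a (δ 0) (λ k → + 2 * δ 1 k) n) ⟩
    ((conv a (δ 0) n - conv a (λ k → + 2 * δ 1 k) n) + conv a (δ r) n) - conv a (δ (suc r)) n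
      ≡⟨ cong (λ i → ((conv a (δ 0) n - i) + conv a (δ r) n) - conv a (δ (suc r)) n) (conv-*ʳ a (+ 2) (δ 1) n) ⟩
    ((conv a (δ 0) n - + 2 * conv a (δ 1) n) + conv a (δ r) n) - conv a (δ (suc r)) n
      ≡⟨ cong₂ _-_ (cong₂ _+_ (cong₂ (λ x y → x - + 2 * y) (shift 0) (shift 1)) (shift r)) (shift (suc r)) ⟩
    ((V (+ n) - + 2 * V (n ⊖ 1)) + V (n ⊖ r)) - V (n ⊖ suc r)
      ∎
    where
    a : ℕ → ℤ
    a k = V (+ k)
    shift : ∀ j → conv a (δ j) n ≡ V (n ⊖ j)
    shift j = conv-δ V V⁻≡0 j n

open Convolution

module RunCounting (r : ℕ) where

  open import Data.Nat using (_+_)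

  Avoids : List ℕ → Set
  Avoids l = ¬ Any (_≡ r) l

  avoids? : Decidable Avoids
  avoids? l = ¬? (any? (ℕ._≟ r) l)

  avoids-tail : ∀ {k l} → Avoids (k ∷ l) → Avoids l
  avoids-tail avoid = avoid ∘ there

  avoids-cons : ∀ {k l} → k ≢ r → Avoids l → Avoids (k ∷ l)
  avoids-cons k≢r avoid (here k≡r)  = k≢r k≡r
  avoids-cons k≢r avoid (there any) = avoid any

  module _ {A : Set} (f : A → List ℕ) {k : ℕ} where

    filter-avoids-cons-≡ : k ≡ r → ∀ xs → length (filter (λ x → avoids? (k ∷ f x)) xs) ≡ 0
    filter-avoids-cons-≡ k≡r xs =
      cong length (ListP.filter-none (λ x → avoids? (k ∷ f x)) (universal (λ x avoid → avoid (here k≡r)) xs))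

    filter-avoids-cons-≢ : k ≢ r → ∀ xs →
      length (filter (λ x → avoids? (k ∷ f x)) xs) ≡ length (filter (λ x → avoids? (f x)) xs)
    filter-avoids-cons-≢ k≢r xs = cong length
      (ListP.filter-≐ (λ x → avoids? (k ∷ f x)) (λ x → avoids? (f x)) (avoids-tail , avoids-cons k≢r) xs)

  -- The ways to append m letters to a word ending in a run of k letters b so that
  -- no maximal run has length r.
  completions : Bool → ℕ → ℕ → ℕ
  completions b k m = length (filter (λ w → avoids? (runsFrom b k w)) (allWords m))

  -- The same number, computed by deciding whether the next letter extends the current run
  -- or closes it; in particular it does not depend on b.
  completionCount : ℕ → ℕ → ℕ
  completionCount k zero with k ℕ.≟ r
  ... | yes _ = 0
  ... | no  _ = 1
  completionCount k (suc m) with k ℕ.≟ r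
  ... | yes _ = completionCount (suc k) m
  ... | no  _ = completionCount (suc k) m + completionCount 1 m

  completions-suc : ∀ b k m → completions b k (suc m) ≡
    length (filter (λ w → avoids? (runsFrom b k (false ∷ w))) (allWords m)) +
    length (filter (λ w → avoids? (runsFrom b k (true ∷ w))) (allWords m))
  completions-suc b k m = begin
    length (filter P? (map (false ∷_) ws ++ map (true ∷_) ws))
      ≡⟨ cong length (ListP.filter-++ P? (map (false ∷_) ws) (map (true ∷_) ws)) ⟩
    length (filter P? (map (false ∷_) ws) ++ filter P? (map (true ∷_) ws))
      ≡⟨ ListP.length-++ (filter P? (map (false ∷_) ws)) ⟩
    length (filter P? (map (false ∷_) ws)) + length (filter P? (map (true ∷_) ws))
      ≡⟨ cong₂ _+_ (length-filter-map P? (false ∷_) ws) (length-filter-map P? (true ∷_) ws) ⟩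
    length (filter (λ w → P? (false ∷ w)) ws) + length (filter (λ w → P? (true ∷ w)) ws)
      ∎
    where
    ws = allWords m
    P? = λ w → avoids? (runsFrom b k w)

  completions-split : ∀ b k m → completions b k (suc m) ≡
    completions b (suc k) m + length (filter (λ w → avoids? (k ∷ runsFrom (not b) 1 w)) (allWords m))
  completions-split false k m = completions-suc false k m
  completions-split true  k m = trans (completions-suc true k m) (ℕP.+-comm
    (length (filter (λ w → avoids? (k ∷ runsFrom false 1 w)) (allWords m)))
    (completions true (suc k) m))

  completions≡completionCount : ∀ b k m → completions b k m ≡ completionCount k m
  completions≡completionCount b k zero with k ℕ.≟ r
  ... | yes k≡r = cong length
    (ListP.filter-reject (λ w → avoids? (runsFrom b k w)) {x = []} {xs = []} (λ avoid → avoid (here k≡r)))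
  ... | no  k≢r = cong length
    (ListP.filter-accept (λ w → avoids? (runsFrom b k w)) {x = []} {xs = []} (avoids-cons k≢r λ ()))
  completions≡completionCount b k (suc m) with k ℕ.≟ r
  ... | yes k≡r = trans (completions-split b k m)
                    (trans (cong₂ _+_ (completions≡completionCount b (suc k) m)
                                      (filter-avoids-cons-≡ (runsFrom (not b) 1) k≡r (allWords m)))
                           (ℕP.+-identityʳ _))
  ... | no  k≢r = trans (completions-split b k m)
                    (cong₂ _+_ (completions≡completionCount b (suc k) m)
                               (trans (filter-avoids-cons-≢ (runsFrom (not b) 1) k≢r (allWords m))
                                      (completions≡completionCount (not b) 1 m)))

  N-suc : ∀ m → N (+ suc m) r ≡ completionCount 1 m
  N-suc m = trans (length-filter-map (λ w → avoids? (runs w)) (false ∷_) (allWords m))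
                  (completions≡completionCount false 1 m)

  N-⊖-< : ∀ {m n} → m < n → N (m ⊖ n) r ≡ 0
  N-⊖-< m<n = ℤP.+-injective (vanishes-⊖ (λ i → + N i r) (λ _ → refl) m<n)

  cumulativeN : ℕ → ℕ
  cumulativeN zero    = N (+ 0) r
  cumulativeN (suc m) = cumulativeN m + N (+ suc m) r

  completionCount≡cumulativeN : ∀ {k} → r < k → ∀ m → completionCount k m ≡ cumulativeN m
  completionCount≡cumulativeN {k} r<k zero with k ℕ.≟ r
  ... | yes k≡r = ⊥-elim (ℕP.<⇒≢ r<k (sym k≡r))
  ... | no  _   = refl
  completionCount≡cumulativeN {k} r<k (suc m) with k ℕ.≟ r
  ... | yes k≡r = ⊥-elim (ℕP.<⇒≢ r<k (sym k≡r))
  ... | no  _   = cong₂ _+_ (completionCount≡cumulativeN (ℕP.m<n⇒m<1+n r<k) m) (sym (N-suc m))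

  completionCount+N≡cumulativeN : ∀ {k} → k ≤ r → ∀ m →
                                  completionCount k m + N ((m + k) ⊖ r) r ≡ cumulativeN m
  completionCount+N≡cumulativeN {k} k≤r zero with k ℕ.≟ r
  ... | yes refl = cong (λ i → N i r) (ℤP.n⊖n≡0 k)
  ... | no  k≢r  = cong suc (N-⊖-< (ℕP.≤∧≢⇒< k≤r k≢r))
  completionCount+N≡cumulativeN {k} k≤r (suc m) with k ℕ.≟ r
  ... | yes refl = cong₂ _+_ (completionCount≡cumulativeN (ℕP.n<1+n k) m) (cong (λ i → N i r) (begin
    (suc m + k) ⊖ k     ≡⟨ ℤP.⊖-≥ (ℕP.m≤n+m k (suc m)) ⟩
    + ((suc m + k) ∸ k) ≡⟨ cong +_ (ℕP.m+n∸n≡m (suc m) k) ⟩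
    + suc m             ∎))
  ... | no  k≢r  = begin
    (completionCount (suc k) m + completionCount 1 m) + N ((suc m + k) ⊖ r) r
      ≡⟨ cong (λ i → (completionCount (suc k) m + completionCount 1 m) + N (i ⊖ r) r) (ℕP.+-suc m k) ⟨
    (completionCount (suc k) m + completionCount 1 m) + N ((m + suc k) ⊖ r) r
      ≡⟨ xy∙z≈xz∙y (completionCount (suc k) m) (completionCount 1 m) (N ((m + suc k) ⊖ r) r) ⟩
    (completionCount (suc k) m + N ((m + suc k) ⊖ r) r) + completionCount 1 m
      ≡⟨ cong₂ _+_ (completionCount+N≡cumulativeN (ℕP.≤∧≢⇒< k≤r k≢r) m) (sym (N-suc m)) ⟩
    cumulativeN m + N (+ suc m) r
      ∎

  N+N⊖r≡cumulativeN : 1 ≤ r → ∀ m → N (+ suc m) r + N (suc m ⊖ r) r ≡ cumulativeN m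
  N+N⊖r≡cumulativeN 1≤r m = begin
    N (+ suc m) r + N (suc m ⊖ r) r         ≡⟨ cong₂ _+_ (N-suc m) (cong (λ i → N (i ⊖ r) r) (ℕP.+-comm 1 m)) ⟩
    completionCount 1 m + N ((m + 1) ⊖ r) r ≡⟨ completionCount+N≡cumulativeN 1≤r m ⟩
    cumulativeN m                           ∎

module _ (r : ℕ) (1≤r : 1 ≤ r) where

  open RunCounting r
  open import Data.Integer using (_+_)

  Nℤ : ℤ → ℤ
  Nℤ i = + N i r

  N-recurrence : ∀ n → ((Nℤ (+ n) - + 2 * Nℤ (n ⊖ 1)) + Nℤ (n ⊖ r)) - Nℤ (n ⊖ suc r) ≡ numer n
  N-recurrence zero rewrite N-⊖-< 1≤r = refl
  N-recurrence (suc zero) rewrite N-⊖-< {1} {suc r} (s≤s 1≤r) =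
    first-difference (N (+ 1) r) (N (1 ⊖ r) r) (N+N⊖r≡cumulativeN 1≤r 0)
    where
    first-difference : ∀ x y → x ℕ.+ y ≡ 1 → ((+ x - + 2 * + 1) + + y) - + 0 ≡ - + 1
    first-difference x y x+y≡1 = begin
      ((+ x - + 2 * + 1) + + y) - + 0 ≡⟨ rearrange (+ x) (+ y) ⟩
      (+ x + + y) - + 2               ≡⟨ cong (λ s → + s - + 2) x+y≡1 ⟩
      - + 1                           ∎
      where
      rearrange : ∀ X Y → ((X - + 2 * + 1) + Y) - + 0 ≡ (X + Y) - + 2
      rearrange = solve-∀
  N-recurrence (suc (suc m)) rewrite ℤP.[1+m]⊖[1+n]≡m⊖n (suc m) r =
    second-difference (N (+ suc (suc m)) r) (N (suc (suc m) ⊖ r) r) (N (+ suc m) r) (N (suc m ⊖ r) r)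
      (cumulativeN m) (N+N⊖r≡cumulativeN 1≤r (suc m)) (N+N⊖r≡cumulativeN 1≤r m)
    where
    second-difference : ∀ x y b z t → x ℕ.+ y ≡ t ℕ.+ b → b ℕ.+ z ≡ t →
                        ((+ x - + 2 * + b) + + y) - + z ≡ 0ℤ
    second-difference x y b z t x+y≡t+b b+z≡t = begin
      ((+ x - + 2 * + b) + + y) - + z     ≡⟨ regroup (+ x) (+ y) (+ b) (+ z) ⟩
      ((+ x + + y) - + b) - (+ b + + z)   ≡⟨ cong₂ (λ s s' → (+ s - + b) - + s') x+y≡t+b b+z≡t ⟩
      ((+ t + + b) - + b) - + t           ≡⟨ cancel (+ t) (+ b) ⟩
      0ℤ                                  ∎
      where
      regroup : ∀ X Y B Z → ((X - + 2 * B) + Y) - Z ≡ ((X + Y) - B) - (B + Z)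
      regroup = solve-∀
      cancel : ∀ T B → ((T + B) - B) - T ≡ 0ℤ
      cancel = solve-∀

  N-generatingFunction : ∀ n → conv (λ k → Nℤ (+ k)) (denom r) n ≡ numer n
  N-generatingFunction n = trans (conv-denom Nℤ (λ _ → refl) r n) (N-recurrence n)

denom-zero : ∀ r → 1 ≤ r → denom r 0 ≡ 1ℤ
denom-zero _ (s≤s z≤n) = refl

mainTheorem3 : (r : ℕ) → r ≥ 1 → (W : ℤ → ℤ)
    → (∀ n → W -[1+ n ] ≡ 0ℤ)
    → (∀ n → conv (λ k → W (+ k)) (denom r) n ≡ numer n)
    → ∀ (n : ℤ) → W n ≡ + N n r
mainTheorem3 r 1≤r W W⁻≡0 convW≡numer (+ n) =
  conv-injectiveˡ {λ k → W (+ k)} {λ k → + N (+ k) r} {denom r} (denom-zero r 1≤r)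
    (λ m → trans (convW≡numer m) (sym (N-generatingFunction r 1≤r m))) n
mainTheorem3 r 1≤r W W⁻≡0 convW≡numer -[1+ n ] = W⁻≡0 n
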